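{- For every integer $k\ge 0$, the broadcast time of the graph $AB_k\setminus\{t\}$ is at most $\lceil 4k/3\rceil$.
   Context: The binomial tree $BT_0$ is a single vertex (its root); for $k\ge1$, $BT_k$ is obtained from two disjoint copies of $BT_{k-1}$ by adding an edge between their roots, one of which becomes the root. $B_k$ is $BT_k$ rooted at $s$ together with a new vertex $t$ adjacent to all $2^k$ vertices of $BT_k$. The graph $AB_k$ (with distinguished vertices $s,t$) is defined as follows: for $0\le k\le 3$, $AB_k$ is $B_k$ with an added edge from $s$ to every vertex of $BT_k$ not already adjacent to $s$. For $k=3m+j$ with $m\ge1$ and $j\in\{1,2,3\}$, $AB_k$ is obtained from $AB_{3m}$ by replacing, for every vertex $v\ne t$ of $AB_{3m}$, the edge $\{v,t\}$ by a copy of $AB_j$ whose vertex $s$ is identified with $v$ and whose vertex $t$ is identified with $t$. Broadcasting: initially only an originator holds a message; in each discrete time unit, every informed vertex may inform at most one uninformed neighbor. $b(v,G)$ is the minimum number of time units to inform all vertices from originator $v$, and the broadcast time is $b(G)=\max_v b(v,G)$. -}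

module Defs where

open import Data.Nat using (ℕ; zero; suc; _+_; _*_)
open import Data.Bool using (Bool; true; false)
open import Data.Vec using (Vec; []; _∷_; replicate)
open import Data.Product using (_×_; _,_; ∃-syntax)
open import Data.Sum using (_⊎_)
open import Data.Empty using (⊥)
open import Relation.Binary.PropositionalEquality using (_≡_; _≢_)
open import Relation.Nullary using (¬_)
open import Function.Bundles using (_⇔_)

record Graph : Set₁ where
  field
    V   : Set
    Adj : V → V → Set
open Graph public

-- Vertices of BT_k are bit strings of length k; the
-- leading bit says in which of the two copies of BT_{k-1} the vertex
-- lies (false = the copy containing the root).

btRoot : (k : ℕ) → Vec Bool k
btRoot k = replicate k false

BTAdj : {k : ℕ} → Vec Bool k → Vec Bool k → Set
BTAdj {zero}  []      []      = ⊥
BTAdj {suc k} (b ∷ x) (c ∷ y) =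
  (b ≡ c × BTAdj x y) ⊎ (b ≢ c × x ≡ btRoot k × y ≡ btRoot k)

-- AB_j minus t for small j: BT_j (s = its root) with s joined to every
-- other vertex of BT_j.  (In AB_j the vertex t is adjacent to all
-- vertices of BT_j, so deleting t leaves exactly this graph.)

baseAdj : (j : ℕ) → Vec Bool j → Vec Bool j → Set
baseAdj j x y = BTAdj x y ⊎ (x ≢ y × (x ≡ btRoot j ⊎ y ≡ btRoot j))

base : ℕ → Graph
base j = record { V = Vec Bool j ; Adj = baseAdj j }

-- Replacing, for every vertex v ≠ t of a graph H (all adjacent to t),
-- the edge {v,t} by a copy of AB_j glued with s = v and t = t, and then
-- deleting t.  Given G = H minus t, the resulting graph has vertices
-- (v , w) with v ∈ V(G), w ∈ V(BT_j), where (v , root) is identified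
-- with v itself; every vertex of the result is again adjacent to t.
ext : Graph → ℕ → Graph
ext G j = record
  { V   = V G × Vec Bool j
  ; Adj = λ { (v , w) (v′ , w′) →
              (w ≡ btRoot j × w′ ≡ btRoot j × Adj G v v′)
            ⊎ (v ≡ v′ × baseAdj j w w′) } }

-- ab3 m = AB_{3(m+1)} minus t.
ab3 : ℕ → Graph
ab3 zero    = base 3
ab3 (suc m) = ext (ab3 m) 3

-- big m n = AB_{3(m+1)+n+1} minus t  (recursing until n ∈ {0,1,2}).
big : ℕ → ℕ → Graph
big m zero                      = ext (ab3 m) 1
big m (suc zero)                = ext (ab3 m) 2
big m (suc (suc zero))          = ext (ab3 m) 3
big m (suc (suc (suc n)))       = big (suc m) n

ABminusT : ℕ → Graph
ABminusT zero                          = base 0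
ABminusT (suc zero)                    = base 1
ABminusT (suc (suc zero))              = base 2
ABminusT (suc (suc (suc zero)))        = base 3
ABminusT (suc (suc (suc (suc n))))     = big 0 n

-- Calls r u v : during time unit r+1, informed u informs uninformed
-- neighbour v.

record BroadcastScheme (G : Graph) (o : V G) (T : ℕ) : Set₁ where
  field
    Informed        : ℕ → V G → Set
    Calls           : ℕ → V G → V G → Set
    init            : ∀ v → Informed 0 v ⇔ (v ≡ o)
    step            : ∀ r v → Informed (suc r) v ⇔ (Informed r v ⊎ ∃[ u ] Calls r u v)
    call-informed   : ∀ {r u v} → Calls r u v → Informed r u
    call-uninformed : ∀ {r u v} → Calls r u v → ¬ Informed r v
    call-adj        : ∀ {r u v} → Calls r u v → Adj G u v
    one-call        : ∀ {r u v v′} → Calls r u v → Calls r u v′ → v ≡ v′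
    complete        : ∀ v → Informed T v

BroadcastFromAtMost : (G : Graph) → V G → ℕ → Set₁
BroadcastFromAtMost G o T = BroadcastScheme G o T

BroadcastTimeAtMost : Graph → ℕ → Set₁
BroadcastTimeAtMost G T = ∀ o → BroadcastFromAtMost G o T

-- Broadcast along a spanning tree in which every vertex is called by a fixed
-- parent.  AB_{3m+j} ∖ t arises from G = AB_{3m} ∖ t by hanging a copy of BT_j,
-- joined by a star to its root, on every vertex ("hub") of G.  From a hub, first
-- broadcast in G and then let all hubs inform their copies simultaneously along
-- the binomial tree, in j more rounds; an originator inside a copy first calls
-- its hub, one round more.  So b(AB_{3m+j} ∖ t) ≤ b(AB_{3m} ∖ t) + j + 1, which
-- gives 4m for AB_{3m} ∖ t, and j + 1 = ⌈4j/3⌉ more for j ∈ {1, 2, 3}.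
module Submission where

open import Defs
open import Data.Nat using (ℕ; _+_; _*_)
open import Data.Nat.DivMod using (_/_)

open import Data.Nat using (zero; suc; _≤_; _≟_; z≤n; s≤s)
open import Data.Nat.Properties
open import Data.Nat.DivMod using (/-congˡ; +-distrib-/-∣ʳ)
open import Data.Nat.Divisibility using (divides-refl)
open import Data.Nat.Tactic.RingSolver using (solve-∀)
open import Data.Bool using (Bool; true; false)
import Data.Bool.Properties as Bool
open import Data.Vec using (Vec; []; _∷_)
open import Data.Vec.Properties using (∷-injective; ≡-dec)
open import Data.Product using (_×_; _,_; proj₁; proj₂; map₂; ∃-syntax)
open import Data.Product.Properties using (,-injective)
open import Data.Sum using (_⊎_; inj₁; inj₂)
import Data.Sum as Sum
open import Relation.Binary.PropositionalEquality
open import Relation.Nullary using (Dec; yes; no; contradiction)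
open import Relation.Nullary.Decidable using (map′; _×-dec_)
open import Function.Bundles using (mk⇔)

private
  variable
    G : Graph
    T T′ : ℕ

-- Vertex v ≠ o is informed by parent v during time unit time v; injectivity of
-- the parent on each time level says that nobody makes two calls at once.
record BroadcastTree (G : Graph) (o : V G) (T : ℕ) : Set where
  field
    time             : V G → ℕ
    parent           : V G → V G
    time-origin      : time o ≡ 0
    time≡0⇒origin    : ∀ v → time v ≡ 0 → v ≡ o
    parent-calls     : ∀ v r → time v ≡ suc r →
                       time (parent v) ≤ r × Adj G (parent v) v
    parent-injective : ∀ v v′ r → time v ≡ suc r → time v′ ≡ suc r →
                       parent v ≡ parent v′ → v ≡ v′
    time≤            : ∀ v → time v ≤ T

open BroadcastTree

toScheme : ∀ {o} → BroadcastTree G o T → BroadcastScheme G o T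
toScheme S = record
  { Informed        = λ r v → time S v ≤ r
  ; Calls           = λ r u v → parent S v ≡ u × time S v ≡ suc r
  ; init            = λ v → mk⇔ (λ t≤0 → time≡0⇒origin S v (n≤0⇒n≡0 t≤0))
                                (λ { refl → ≤-reflexive (time-origin S) })
  ; step            = λ r v → mk⇔ (informed-by r v) (informed-later r v)
  ; call-informed   = λ { {r} {u} {v} (refl , t) → proj₁ (parent-calls S v r t) }
  ; call-uninformed = λ { (_ , t) t≤r → 1+n≰n (≤-trans (≤-reflexive (sym t)) t≤r) }
  ; call-adj        = λ { {r} {u} {v} (refl , t) → proj₂ (parent-calls S v r t) }
  ; one-call        = λ { {r} {u} {v} {v′} (p , t) (p′ , t′) →
                          parent-injective S v v′ r t t′ (trans p (sym p′)) }
  ; complete        = time≤ S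
  }
  where
  informed-by : ∀ r v → time S v ≤ suc r →
                time S v ≤ r ⊎ ∃[ u ] (parent S v ≡ u × time S v ≡ suc r)
  informed-by r v t≤1+r with time S v ≤? r
  ... | yes t≤r = inj₁ t≤r
  ... | no  t≰r = inj₂ (parent S v , refl , ≤-antisym t≤1+r (≰⇒> t≰r))

  informed-later : ∀ r v → time S v ≤ r ⊎ ∃[ u ] (parent S v ≡ u × time S v ≡ suc r) →
                   time S v ≤ suc r
  informed-later r v (inj₁ t≤r)          = m≤n⇒m≤1+n t≤r
  informed-later r v (inj₂ (_ , _ , t)) = ≤-reflexive t

weaken : ∀ {o} → T ≤ T′ → BroadcastTree G o T → BroadcastTree G o T′
weaken T≤T′ S = record
  { time             = time S
  ; parent           = parent S
  ; time-origin      = time-origin S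
  ; time≡0⇒origin    = time≡0⇒origin S
  ; parent-calls     = parent-calls S
  ; parent-injective = parent-injective S
  ; time≤            = λ v → ≤-trans (time≤ S v) T≤T′
  }

≟-origin : ∀ {o} → BroadcastTree G o T → ∀ v → Dec (v ≡ o)
≟-origin S v = map′ (time≡0⇒origin S v) (λ { refl → time-origin S }) (time S v ≟ 0)

-- The new originator y calls the old one x in the first round, after which S
-- runs one round late.  The first call does not collide with any call y makes
-- in S, since those happen in later rounds.
module Reroot {G : Graph} {x y : V G} {T : ℕ} (S : BroadcastTree G x T)
              (y→x : Adj G y x) (_≟y : ∀ z → Dec (z ≡ y)) where

  delayed : ∀ {z} → Dec (z ≡ y) → ℕ → ℕ
  delayed (yes _) _ = 0
  delayed (no _)  t = suc t

  parent-or-y : ℕ → V G → V G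
  parent-or-y zero    _ = y
  parent-or-y (suc _) p = p

  time′ : V G → ℕ
  time′ z = delayed (z ≟y) (time S z)

  parent′ : V G → V G
  parent′ z = parent-or-y (time S z) (parent S z)

  time′≤ : ∀ z → time′ z ≤ suc (time S z)
  time′≤ z with z ≟y
  ... | yes _ = z≤n
  ... | no  _ = ≤-refl

  time′-origin : time′ y ≡ 0
  time′-origin with y ≟y
  ... | yes _  = refl
  ... | no y≢y = contradiction refl y≢y

  time′≡0⇒origin : ∀ z → time′ z ≡ 0 → z ≡ y
  time′≡0⇒origin z t with z ≟y
  ... | yes z≡y = z≡y
  time′≡0⇒origin z () | no _

  parent′-calls : ∀ z r → time′ z ≡ suc r → time′ (parent′ z) ≤ r × Adj G (parent′ z) z
  parent′-calls z r t with z ≟y | time S z in tz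
  parent′-calls z r refl | no _ | zero =
    ≤-reflexive time′-origin , subst (Adj G y) (sym (time≡0⇒origin S z tz)) y→x
  parent′-calls z r refl | no _ | suc n =
    let pt≤n , p→z = parent-calls S z n tz in
    ≤-trans (time′≤ (parent S z)) (s≤s pt≤n) , p→z

  parent′-injective : ∀ z z′ r → time′ z ≡ suc r → time′ z′ ≡ suc r →
                      parent′ z ≡ parent′ z′ → z ≡ z′
  parent′-injective z z′ r t t′ p
    with z ≟y | z′ ≟y | time S z in tz | time S z′ in tz′
  ... | no _ | no _ | zero  | zero  = trans (time≡0⇒origin S z tz) (sym (time≡0⇒origin S z′ tz′))
  ... | no _ | no _ | suc n | suc n′ with refl ← t | refl ← t′ =
    parent-injective S z z′ n tz tz′ p
  parent′-injective z z′ r refl () p | no _ | no _ | zero | suc _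
  parent′-injective z z′ r refl () p | no _ | no _ | suc _ | zero

  tree : BroadcastTree G y (suc T)
  tree = record
    { time             = time′
    ; parent           = parent′
    ; time-origin      = time′-origin
    ; time≡0⇒origin    = time′≡0⇒origin
    ; parent-calls     = parent′-calls
    ; parent-injective = parent′-injective
    ; time≤            = λ z → ≤-trans (time′≤ z) (s≤s (time≤ S z))
    }

fromNeighbour : ∀ {x} → BroadcastTree G x T → ∀ y → y ≡ x ⊎ Adj G y x →
                (∀ z → Dec (z ≡ y)) → BroadcastTree G y (suc T)
fromNeighbour {T = T} S y (inj₁ refl) _   = weaken (n≤1+n T) S
fromNeighbour         S y (inj₂ y→x)  _≟y = Reroot.tree S y→x _≟y

-- The binomial broadcast in BT_{k+1}: in the first round the root false ∷ 0ᵏ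
-- calls true ∷ 0ᵏ, the root of the other half, and then both halves broadcast
-- recursively one round later.
binomialStep : Bool → ℕ → ℕ
binomialStep _     (suc t) = suc (suc t)
binomialStep false zero    = 0
binomialStep true  zero    = 1

binomialTime : ∀ {k} → Vec Bool k → ℕ
binomialTime []      = 0
binomialTime (b ∷ x) = binomialStep b (binomialTime x)

binomialParentStep : ∀ {k} → Bool → Vec Bool k → ℕ → Vec Bool k → Vec Bool (suc k)
binomialParentStep b x zero    _  = false ∷ x
binomialParentStep b x (suc _) px = b ∷ px

binomialParent : ∀ {k} → Vec Bool k → Vec Bool k
binomialParent []      = []
binomialParent (b ∷ x) = binomialParentStep b x (binomialTime x) (binomialParent x)

binomialTime-root : ∀ k → binomialTime (btRoot k) ≡ 0
binomialTime-root zero    = refl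
binomialTime-root (suc k) rewrite binomialTime-root k = refl

binomialTime≡0⇒root : ∀ {k} (x : Vec Bool k) → binomialTime x ≡ 0 → x ≡ btRoot k
binomialTime≡0⇒root []      _ = refl
binomialTime≡0⇒root (b ∷ x) t with binomialTime x in tx
binomialTime≡0⇒root (false ∷ x) _  | zero  = cong (false ∷_) (binomialTime≡0⇒root x tx)
binomialTime≡0⇒root (true  ∷ x) () | zero
binomialTime≡0⇒root (b     ∷ x) () | suc _

binomialStep≤ : ∀ b t → binomialStep b t ≤ suc t
binomialStep≤ _     (suc t) = ≤-refl
binomialStep≤ false zero    = z≤n
binomialStep≤ true  zero    = ≤-refl

binomialTime≤ : ∀ {k} (x : Vec Bool k) → binomialTime x ≤ k
binomialTime≤ []      = z≤n
binomialTime≤ (b ∷ x) = ≤-trans (binomialStep≤ b _) (s≤s (binomialTime≤ x))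

binomialParent-calls : ∀ {k} (x : Vec Bool k) r → binomialTime x ≡ suc r →
                       binomialTime (binomialParent x) ≤ r × BTAdj (binomialParent x) x
binomialParent-calls (b ∷ x) r t with binomialTime x in tx
binomialParent-calls (true ∷ x) r refl | zero =
  ≤-reflexive (cong (binomialStep false) tx) , inj₂ ((λ ()) , root , root)
  where root = binomialTime≡0⇒root x tx
binomialParent-calls (b ∷ x) r refl | suc n =
  let pt≤n , p→x = binomialParent-calls x n tx in
  ≤-trans (binomialStep≤ b _) (s≤s pt≤n) , inj₁ (refl , p→x)

binomialParent-injective : ∀ {k} (x y : Vec Bool k) r →
                           binomialTime x ≡ suc r → binomialTime y ≡ suc r →
                           binomialParent x ≡ binomialParent y → x ≡ y
binomialParent-injective [] [] _ _ _ _ = refl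
binomialParent-injective (b ∷ x) (c ∷ y) r t t′ p
  with binomialTime x in tx | binomialTime y in ty
binomialParent-injective (true ∷ x) (true ∷ y) r t t′ p | zero | zero =
  cong (true ∷_) (trans (binomialTime≡0⇒root x tx) (sym (binomialTime≡0⇒root y ty)))
binomialParent-injective (false ∷ x) _ r () t′ p | zero | _
binomialParent-injective _ (false ∷ y) r t () p | _ | zero
binomialParent-injective (true ∷ x) _ r refl () p | zero | suc _
binomialParent-injective _ (true ∷ y) r () refl p | suc _ | zero
binomialParent-injective (b ∷ x) (c ∷ y) r refl refl p | suc n | suc n =
  let b≡c , px≡py = ∷-injective p in
  cong₂ _∷_ b≡c (binomialParent-injective x y n tx ty px≡py)

binomial : ∀ j → BroadcastTree (base j) (btRoot j) j
binomial j = record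
  { time             = binomialTime
  ; parent           = binomialParent
  ; time-origin      = binomialTime-root j
  ; time≡0⇒origin    = binomialTime≡0⇒root
  ; parent-calls     = λ x r t → map₂ inj₁ (binomialParent-calls x r t)
  ; parent-injective = binomialParent-injective
  ; time≤            = binomialTime≤
  }

-- Hubs (v , 0ʲ) are informed as in S, all other vertices of the copy of v as in
-- B started at time T, when every hub is informed.
module HubExtension {G : Graph} {o : V G} {T : ℕ} {j J : ℕ}
                    (S : BroadcastTree G o T) (B : BroadcastTree (base j) (btRoot j) J) where

  layeredTime : ℕ → ℕ → ℕ
  layeredTime h zero    = h
  layeredTime _ (suc n) = T + suc n

  layeredParent : V G → Vec Bool j → ℕ → V G × Vec Bool j
  layeredParent v w zero    = parent S v , w
  layeredParent v w (suc _) = v , parent B w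

  time′ : V G × Vec Bool j → ℕ
  time′ (v , w) = layeredTime (time S v) (time B w)

  parent′ : V G × Vec Bool j → V G × Vec Bool j
  parent′ (v , w) = layeredParent v w (time B w)

  hub-before-leaves : ∀ v n → time S v ≢ T + suc n
  hub-before-leaves v n t = m+1+n≰m T (subst (_≤ T) t (time≤ S v))

  time′≤ : ∀ v w → time′ (v , w) ≤ T + time B w
  time′≤ v w with time B w
  ... | zero  = ≤-trans (time≤ S v) (m≤m+n T 0)
  ... | suc _ = ≤-refl

  time′-hub : ∀ v {w} → time B w ≡ 0 → time′ (v , w) ≡ time S v
  time′-hub v tw rewrite tw = refl

  time′-origin : time′ (o , btRoot j) ≡ 0
  time′-origin = trans (time′-hub o (time-origin B)) (time-origin S)

  time′≡0⇒origin : ∀ x → time′ x ≡ 0 → x ≡ (o , btRoot j)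
  time′≡0⇒origin (v , w) t with time B w in tw
  ... | zero  = cong₂ _,_ (time≡0⇒origin S v t) (time≡0⇒origin B w tw)
  ... | suc n = contradiction t (m+1+n≢0 T)

  parent′-calls : ∀ x r → time′ x ≡ suc r → time′ (parent′ x) ≤ r × Adj (ext G j) (parent′ x) x
  parent′-calls (v , w) r t with time B w in tw
  ... | zero  =
    let pt≤r , p→v = parent-calls S v r t
        w≡root     = time≡0⇒origin B w tw
    in subst (_≤ r) (sym (time′-hub (parent S v) tw)) pt≤r , inj₁ (w≡root , w≡root , p→v)
  ... | suc n with refl ← suc-injective (trans (sym (+-suc T n)) t) =
    let pt≤n , p→w = parent-calls B w n tw in
    ≤-trans (time′≤ v (parent B w)) (+-monoʳ-≤ T pt≤n) , inj₂ (refl , p→w)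

  parent′-injective : ∀ x x′ r → time′ x ≡ suc r → time′ x′ ≡ suc r → parent′ x ≡ parent′ x′ → x ≡ x′
  parent′-injective (v , w) (v′ , w′) r t t′ p with time B w in tw | time B w′ in tw′
  ... | zero  | zero   =
    cong₂ _,_ (parent-injective S v v′ r t t′ (proj₁ (,-injective p))) (proj₂ (,-injective p))
  ... | zero  | suc n′ = contradiction (trans t (sym t′)) (hub-before-leaves v n′)
  ... | suc n | zero   = contradiction (trans t′ (sym t)) (hub-before-leaves v′ n)
  ... | suc n | suc n′ with refl ← +-cancelˡ-≡ T (suc n) (suc n′) (trans t (sym t′)) =
    let v≡v′ , pw≡pw′ = ,-injective p in
    cong₂ _,_ v≡v′ (parent-injective B w w′ n tw tw′ pw≡pw′)

  tree : BroadcastTree (ext G j) (o , btRoot j) (T + J)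
  tree = record
    { time             = time′
    ; parent           = parent′
    ; time-origin      = time′-origin
    ; time≡0⇒origin    = time′≡0⇒origin
    ; parent-calls     = parent′-calls
    ; parent-injective = parent′-injective
    ; time≤            = λ (v , w) → ≤-trans (time′≤ v w) (+-monoʳ-≤ T (time≤ B w))
    }

_≟ᵥ_ : ∀ {k} (x y : Vec Bool k) → Dec (x ≡ y)
_≟ᵥ_ = ≡-dec Bool._≟_

root-or-adjacent : ∀ {j} (w : Vec Bool j) → w ≡ btRoot j ⊎ baseAdj j w (btRoot j)
root-or-adjacent {j} w with w ≟ᵥ btRoot j
... | yes w≡root = inj₁ w≡root
... | no  w≢root = inj₂ (inj₂ (w≢root , inj₂ refl))

baseTree : ∀ j w → BroadcastTree (base j) w (suc j)
baseTree j w = fromNeighbour (binomial j) w (root-or-adjacent w) (_≟ᵥ w)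

extTree : (∀ o → BroadcastTree G o T) → ∀ j x → BroadcastTree (ext G j) x (suc j + T)
extTree {G} {T} trees j (o , w) =
  subst (BroadcastTree (ext G j) (o , w)) (cong suc (+-comm T j))
        (fromNeighbour (HubExtension.tree (trees o) (binomial j)) (o , w) hub-or-adjacent _≟ow)
  where
  hub-or-adjacent : (o , w) ≡ (o , btRoot j) ⊎ Adj (ext G j) (o , w) (o , btRoot j)
  hub-or-adjacent = Sum.map (cong (o ,_)) (λ w→root → inj₂ (refl , w→root)) (root-or-adjacent w)

  _≟ow : ∀ x → Dec (x ≡ (o , w))
  (v , u) ≟ow = map′ (λ (v≡o , u≡w) → cong₂ _,_ v≡o u≡w) ,-injective
                     (≟-origin (trees o) v ×-dec u ≟ᵥ w)

ab3Tree : ∀ m o → BroadcastTree (ab3 m) o (suc m * 4)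
ab3Tree zero    o = baseTree 3 o
ab3Tree (suc m) o = extTree (ab3Tree m) 3 o

⌈4k/3⌉ : ℕ → ℕ
⌈4k/3⌉ k = (4 * k + 2) / 3

⌈4k/3⌉-+3 : ∀ k → ⌈4k/3⌉ (3 + k) ≡ ⌈4k/3⌉ k + 4
⌈4k/3⌉-+3 k = begin
  (4 * (3 + k) + 2) / 3     ≡⟨ /-congˡ (4[3+k]+2≡4k+2+4*3 k) ⟩
  (4 * k + 2 + 4 * 3) / 3   ≡⟨ +-distrib-/-∣ʳ (4 * k + 2) (divides-refl 4) ⟩
  ⌈4k/3⌉ k + 4              ∎
  where
  open ≡-Reasoning
  4[3+k]+2≡4k+2+4*3 : ∀ k → 4 * (3 + k) + 2 ≡ 4 * k + 2 + 4 * 3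
  4[3+k]+2≡4k+2+4*3 = solve-∀

bigTree : ∀ m n o → BroadcastTree (big m n) o (⌈4k/3⌉ (suc n) + suc m * 4)
bigTree m 0 o = extTree (ab3Tree m) 1 o
bigTree m 1 o = extTree (ab3Tree m) 2 o
bigTree m 2 o = extTree (ab3Tree m) 3 o
bigTree m (suc (suc (suc n))) o =
  subst (BroadcastTree (big (suc m) n) o) (sym bound≡) (bigTree (suc m) n o)
  where
  open ≡-Reasoning
  bound≡ : ⌈4k/3⌉ (3 + suc n) + suc m * 4 ≡ ⌈4k/3⌉ (suc n) + suc (suc m) * 4
  bound≡ = begin
    ⌈4k/3⌉ (3 + suc n) + suc m * 4   ≡⟨ cong (_+ suc m * 4) (⌈4k/3⌉-+3 (suc n)) ⟩
    ⌈4k/3⌉ (suc n) + 4 + suc m * 4   ≡⟨ +-assoc (⌈4k/3⌉ (suc n)) 4 (suc m * 4) ⟩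
    ⌈4k/3⌉ (suc n) + suc (suc m) * 4 ∎

lemma4 : ∀ (k : ℕ) → BroadcastTimeAtMost (ABminusT k) ((4 * k + 2) / 3)
lemma4 0 []    = toScheme (binomial 0)
lemma4 1 o     = toScheme (baseTree 1 o)
lemma4 2 o     = toScheme (baseTree 2 o)
lemma4 3 o     = toScheme (baseTree 3 o)
lemma4 (suc (suc (suc (suc n)))) o =
  toScheme (subst (BroadcastTree (big 0 n) o) (sym (⌈4k/3⌉-+3 (suc n))) (bigTree 0 n o))
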